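{- Let $n,m\in\mathbb{N}$, let $R$ be a set of jump sizes containing some $r$ with $m>1$, $m\mid\gcd(n,r)$ and $m^3\mid n$. Let $V_{n,m}(C_n(R))=\{\theta_{n,m,t}(C_n(R)): t=0,1,\dots,\tfrac{n}{m}-1\}$, with the operation $\circ$ defined by $\theta_{n,m,t}(C_n(R))\circ\theta_{n,m,t'}(C_n(R))=\theta_{n,m,t+t'}(C_n(R))$, where $t+t'$ is computed modulo $\tfrac{n}{m}$. Then $(V_{n,m}(C_n(R)),\circ)$ is an Abelian group.
   Context: Circulant graph $C_n(R)$: vertex set $\{v_0,\dots,v_{n-1}\}$ (indices in $\mathbb{Z}_n$), with $v_x$ adjacent to $v_{x\pm s}$ for $s\in R$; jump sets are written in $[1,n/2]$ after reflexive reduction (reduce modulo $n$, replace values $>n/2$ by $n$ minus the value). For $m\mid n$ and $0\le t\le \tfrac nm-1$, the map $\theta_{n,m,t}$ sends vertex $v_x$, where $x=qm+j$ with $0\le j\le m-1$, to $u_{x+jmt}$ (subscripts modulo $n$), with $V(K_n)=\{u_0,\dots,u_{n-1}\}$, and sends each edge $(v_x,v_{x+s})$, $s\in R$, to $(\theta_{n,m,t}(v_x),\theta_{n,m,t}(v_{x+s}))$; $\theta_{n,m,t}(C_n(R))$ denotes the resulting image graph, written $C_n(\theta_{n,m,t}(R))$ with $\theta_{n,m,t}(R)$ computed under reflexive modulo $n$. -}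

module Defs where

open import Data.Nat using (ℕ; zero; suc; _+_; _*_; NonZero)
open import Data.Nat.DivMod using (_%_; _mod_)
open import Data.Fin using (Fin; toℕ)
open import Data.List using (List)
open import Data.List.Membership.Propositional using (_∈_)
open import Data.Product using (Σ; _×_; ∃)
open import Data.Sum using (_⊎_)
open import Data.Nat using (_<_)
open import Relation.Binary.PropositionalEquality using (_≡_)
open import Function.Bundles using (_⇔_)

-- Vertices of C_n(R) and of K_n are v_x / u_x with x ∈ {0,…,n-1} (naturals < n).

θ : (n m t x : ℕ) .{{_ : NonZero n}} .{{_ : NonZero m}} → ℕ
θ n m t x = (x + (x % m) * m * t) % n

ImgAdj : (n m : ℕ) .{{_ : NonZero n}} .{{_ : NonZero m}} (R : List ℕ) (t u w : ℕ) → Set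
ImgAdj n m R t u w =
  Σ ℕ λ x → x < n × Σ ℕ λ s → s ∈ R ×
    ((u ≡ θ n m t x × w ≡ θ n m t ((x + s) % n))
     ⊎ (w ≡ θ n m t x × u ≡ θ n m t ((x + s) % n)))

-- Equality of image graphs: same vertex set V(K_n), same edge set.
SameImage : (n m : ℕ) .{{_ : NonZero n}} .{{_ : NonZero m}} (R : List ℕ) {k : ℕ} →
            Fin k → Fin k → Set
SameImage n m R t t' = ∀ u w → ImgAdj n m R (toℕ t) u w ⇔ ImgAdj n m R (toℕ t') u w

addMod : {k : ℕ} → Fin k → Fin k → Fin k
addMod {suc k} a b = (toℕ a + toℕ b) mod suc k

-- When m ∣ n, the residue x mod m is unchanged by θ, so θ_{n,m,t} is translation of every vertex
-- x ≡ j (mod m) by j m t.  Hence θ_b ∘ θ_a = θ_{a+b}, and θ_t only depends on t modulo k = n/m.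
-- The image of C_n(R) under θ_{a+b} is the image under θ_b of the image under θ_a, so having the
-- same image graph is a congruence for addition; the group laws then hold already on the level of
-- vertex maps, with -t = k - t as inverse.
module Submission where

open import Defs
open import Data.Nat using (ℕ; _<_; _≤_; _/_; _^_; NonZero; zero; suc; _+_; _*_; _∸_; _%_)
open import Data.Nat.Base using (≢-nonZero⁻¹)
open import Data.Nat.Properties using (+-comm; +-assoc; +-identityʳ; *-comm; *-zeroʳ; m+[n∸m]≡n; <⇒≤)
open import Data.Nat.DivMod
  using (_mod_; %-distribˡ-+; m%n%n≡m%n; %-remove-+ʳ; m∣n⇒o%n%m≡o%m; [m+kn]%n≡m%n;
         m≡m%n+[m/n]*n; m%n<n; n%n≡0; m/n*n≡m)
open import Data.Nat.Divisibility using (_∣_; ∣-trans; n∣m*n*o)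
open import Data.Nat.GCD using (gcd; gcd[m,n]∣m)
open import Data.Nat.Solver using (module +-*-Solver)
open import Data.Fin using (Fin; toℕ)
open import Data.Fin.Properties using (toℕ-fromℕ<; toℕ<n)
open import Data.List using (List)
open import Data.List.Membership.Propositional using (_∈_)
open import Data.List.Relation.Unary.All using (All)
open import Data.Product using (Σ; _×_; _,_; ∃₂)
open import Data.Sum using (inj₁; inj₂)
open import Data.Empty using (⊥-elim)
open import Function.Bundles using (_⇔_; mk⇔; Equivalence)
import Function.Properties.Equivalence as ⇔
open import Relation.Binary.Bundles using (Setoid)
open import Relation.Binary.Structures using (IsEquivalence)
open import Relation.Binary.PropositionalEquality using (_≡_; _≗_; refl; sym; trans; cong; module ≡-Reasoning)
import Relation.Binary.Reasoning.Setoid as SetoidReasoning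
open import Algebra.Structures using (IsAbelianGroup)

open +-*-Solver using (solve; _:=_; _:+_; _:*_)

Image : (ℕ → ℕ) → (ℕ → ℕ → Set) → ℕ → ℕ → Set
Image f E u w = ∃₂ λ u₀ w₀ → E u₀ w₀ × u ≡ f u₀ × w ≡ f w₀

Image-mono : ∀ f {E F : ℕ → ℕ → Set} → (∀ {u w} → E u w → F u w) →
             ∀ {u w} → Image f E u w → Image f F u w
Image-mono f E⇒F (u₀ , w₀ , e , p , q) = u₀ , w₀ , E⇒F e , p , q

module _ (n m : ℕ) .{{_ : NonZero n}} .{{_ : NonZero m}} where

  -- θ takes its instance arguments after the vertex, so θ n m t is not a function ℕ → ℕ.
  θ[_] : ℕ → ℕ → ℕ
  θ[ t ] x = θ n m t x

  [x%n+y]%n≡[x+y]%n : ∀ x y → (x % n + y) % n ≡ (x + y) % n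
  [x%n+y]%n≡[x+y]%n x y = begin
    (x % n + y) % n          ≡⟨ %-distribˡ-+ (x % n) y n ⟩
    (x % n % n + y % n) % n  ≡⟨ cong (λ z → (z + y % n) % n) (m%n%n≡m%n x n) ⟩
    (x % n + y % n) % n      ≡⟨ %-distribˡ-+ x y n ⟨
    (x + y) % n              ∎
    where open ≡-Reasoning

  θ-∘ : m ∣ n → ∀ a b x → θ[ b ] (θ[ a ] x) ≡ θ[ a + b ] x
  θ-∘ m∣n a b x = begin
    (y + y % m * m * b) % n        ≡⟨ cong (λ i → (y + i * m * b) % n) y%m≡j ⟩
    (y + j * m * b) % n            ≡⟨ [x%n+y]%n≡[x+y]%n (x + j * m * a) (j * m * b) ⟩
    (x + j * m * a + j * m * b) % n ≡⟨ cong (_% n) (distrib x j m a b) ⟩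
    (x + j * m * (a + b)) % n      ∎
    where
    open ≡-Reasoning
    j = x % m
    y = θ[ a ] x
    y%m≡j : y % m ≡ j
    y%m≡j = trans (m∣n⇒o%n%m≡o%m m n (x + j * m * a) m∣n) (%-remove-+ʳ x (n∣m*n*o j a))
    distrib : ∀ x j m a b → x + j * m * a + j * m * b ≡ x + j * m * (a + b)
    distrib = solve 5 (λ x j m a b → x :+ j :* m :* a :+ j :* m :* b := x :+ j :* m :* (a :+ b)) refl

  θ-% : ∀ k .{{_ : NonZero k}} → m * k ≡ n → ∀ t x → θ[ t % k ] x ≡ θ[ t ] x
  θ-% k mk≡n t x = begin
    (x + j * m * (t % k)) % n                       ≡⟨ [m+kn]%n≡m%n _ (j * (t / k)) n ⟨
    (x + j * m * (t % k) + j * (t / k) * n) % n     ≡⟨ cong (λ z → (x + j * m * (t % k) + j * (t / k) * z) % n) mk≡n ⟨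
    (x + j * m * (t % k) + j * (t / k) * (m * k)) % n ≡⟨ cong (_% n) (distrib x j m (t % k) (t / k) k) ⟩
    (x + j * m * (t % k + t / k * k)) % n           ≡⟨ cong (λ z → (x + j * m * z) % n) (m≡m%n+[m/n]*n t k) ⟨
    (x + j * m * t) % n                             ∎
    where
    open ≡-Reasoning
    j = x % m
    distrib : ∀ x j m r q k → x + j * m * r + j * q * (m * k) ≡ x + j * m * (r + q * k)
    distrib = solve 6 (λ x j m r q k → x :+ j :* m :* r :+ j :* q :* (m :* k) := x :+ j :* m :* (r :+ q :* k)) refl

  module _ (R : List ℕ) where

    infix 4 _∼_
    _∼_ : ℕ → ℕ → Set
    t ∼ t' = ∀ u w → ImgAdj n m R t u w ⇔ ImgAdj n m R t' u w

    ∼-isEquivalence : IsEquivalence _∼_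
    ∼-isEquivalence = record
      { refl  = λ u w → ⇔.refl
      ; sym   = λ p u w → ⇔.sym (p u w)
      ; trans = λ p q u w → ⇔.trans (p u w) (q u w)
      }

    ∼-setoid : Setoid _ _
    ∼-setoid = record { isEquivalence = ∼-isEquivalence }

    ImgAdj-resp-≗ : ∀ {t t'} → θ[ t ] ≗ θ[ t' ] → ∀ {u w} → ImgAdj n m R t u w → ImgAdj n m R t' u w
    ImgAdj-resp-≗ t≗t' (x , x<n , s , s∈R , inj₁ (p , q)) =
      x , x<n , s , s∈R , inj₁ (trans p (t≗t' x) , trans q (t≗t' _))
    ImgAdj-resp-≗ t≗t' (x , x<n , s , s∈R , inj₂ (p , q)) =
      x , x<n , s , s∈R , inj₂ (trans p (t≗t' x) , trans q (t≗t' _))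

    ≗⇒∼ : ∀ {t t'} → θ[ t ] ≗ θ[ t' ] → t ∼ t'
    ≗⇒∼ t≗t' u w = mk⇔ (ImgAdj-resp-≗ t≗t') (ImgAdj-resp-≗ (λ x → sym (t≗t' x)))

    +-comm-∼ : ∀ a b → a + b ∼ b + a
    +-comm-∼ a b = ≗⇒∼ (λ x → cong (λ t → θ[ t ] x) (+-comm a b))

    module _ (m∣n : m ∣ n) where

      ImgAdj-+ : ∀ a b {u w} → ImgAdj n m R (a + b) u w ⇔ Image θ[ b ] (ImgAdj n m R a) u w
      ImgAdj-+ a b = mk⇔ to from
        where
        θ-∘˘ : ∀ x → θ[ a + b ] x ≡ θ[ b ] (θ[ a ] x)
        θ-∘˘ x = sym (θ-∘ m∣n a b x)
        through : ∀ {u u₀} x → u ≡ θ[ b ] u₀ → u₀ ≡ θ[ a ] x → u ≡ θ[ a + b ] x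
        through x p q = trans p (trans (cong θ[ b ] q) (θ-∘ m∣n a b x))
        to : ∀ {u w} → ImgAdj n m R (a + b) u w → Image θ[ b ] (ImgAdj n m R a) u w
        to (x , x<n , s , s∈R , inj₁ (p , q)) =
          _ , _ , (x , x<n , s , s∈R , inj₁ (refl , refl)) , trans p (θ-∘˘ x) , trans q (θ-∘˘ _)
        to (x , x<n , s , s∈R , inj₂ (p , q)) =
          _ , _ , (x , x<n , s , s∈R , inj₂ (refl , refl)) , trans q (θ-∘˘ _) , trans p (θ-∘˘ x)
        from : ∀ {u w} → Image θ[ b ] (ImgAdj n m R a) u w → ImgAdj n m R (a + b) u w
        from (_ , _ , (x , x<n , s , s∈R , inj₁ (p , q)) , pu , pw) =
          x , x<n , s , s∈R , inj₁ (through x pu p , through _ pw q)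
        from (_ , _ , (x , x<n , s , s∈R , inj₂ (p , q)) , pu , pw) =
          x , x<n , s , s∈R , inj₂ (through x pw p , through _ pu q)

      +-congʳ-∼ : ∀ {a a'} b → a ∼ a' → a + b ∼ a' + b
      +-congʳ-∼ {a} {a'} b a∼a' u w = mk⇔
        (λ e → from (ImgAdj-+ a' b) (Image-mono θ[ b ] (to (a∼a' _ _)) (to (ImgAdj-+ a b) e)))
        (λ e → from (ImgAdj-+ a b) (Image-mono θ[ b ] (from (a∼a' _ _)) (to (ImgAdj-+ a' b) e)))
        where open Equivalence

      +-congˡ-∼ : ∀ a {b b'} → b ∼ b' → a + b ∼ a + b'
      +-congˡ-∼ a {b} {b'} b∼b' = begin
        a + b   ≈⟨ +-comm-∼ a b ⟩
        b + a   ≈⟨ +-congʳ-∼ a b∼b' ⟩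
        b' + a  ≈⟨ +-comm-∼ b' a ⟩
        a + b'  ∎
        where open SetoidReasoning ∼-setoid

      +-cong-∼ : ∀ {a a' b b'} → a ∼ a' → b ∼ b' → a + b ∼ a' + b'
      +-cong-∼ {a} {a'} a∼a' b∼b' =
        IsEquivalence.trans ∼-isEquivalence (+-congʳ-∼ _ a∼a') (+-congˡ-∼ a' b∼b')

      module _ (k : ℕ) (mk≡n : m * suc k ≡ n) where

        open SetoidReasoning ∼-setoid

        toℕ-mod-∼ : ∀ t → toℕ (t mod suc k) ∼ t
        toℕ-mod-∼ t = ≗⇒∼ λ x →
          trans (cong (λ s → θ[ s ] x) (toℕ-fromℕ< (m%n<n t (suc k)))) (θ-% (suc k) mk≡n t x)

        negMod : Fin (suc k) → Fin (suc k)
        negMod a = (suc k ∸ toℕ a) mod suc k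

        +-negMod-∼ : ∀ a → toℕ a + toℕ (negMod a) ∼ 0
        +-negMod-∼ a = begin
          toℕ a + toℕ (negMod a)    ≈⟨ +-congˡ-∼ (toℕ a) (toℕ-mod-∼ (suc k ∸ toℕ a)) ⟩
          toℕ a + (suc k ∸ toℕ a)   ≡⟨ m+[n∸m]≡n (<⇒≤ (toℕ<n a)) ⟩
          suc k                     ≈⟨ toℕ-mod-∼ (suc k) ⟨
          toℕ (suc k mod suc k)     ≡⟨ toℕ-fromℕ< (m%n<n (suc k) (suc k)) ⟩
          suc k % suc k             ≡⟨ n%n≡0 (suc k) ⟩
          0                         ∎

        isAbelianGroup : IsAbelianGroup (SameImage n m R {suc k}) addMod Fin.zero negMod
        isAbelianGroup = record
          { isGroup = record
            { isMonoid = record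
              { isSemigroup = record
                { isMagma = record
                  { isEquivalence = record
                    { refl = λ {a} → refl′ {toℕ a} ; sym = sym′ ; trans = trans′ }
                  ; ∙-cong = addMod-cong
                  }
                ; assoc = addMod-assoc
                }
              ; identity = addMod-identityˡ , addMod-identityʳ
              }
            ; inverse = addMod-inverseˡ , addMod-inverseʳ
            ; ⁻¹-cong = negMod-cong
            }
          ; comm = addMod-comm
          }
          where
          open IsEquivalence ∼-isEquivalence renaming (refl to refl′; sym to sym′; trans to trans′)
          addMod-∼ : ∀ a b → toℕ (addMod a b) ∼ toℕ a + toℕ b
          addMod-∼ a b = toℕ-mod-∼ (toℕ a + toℕ b)
          addMod-cong : ∀ {a a' b b'} → toℕ a ∼ toℕ a' → toℕ b ∼ toℕ b' →
                        toℕ (addMod a b) ∼ toℕ (addMod a' b')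
          addMod-cong {a} {a'} {b} {b'} a∼a' b∼b' = begin
            toℕ (addMod a b)   ≈⟨ addMod-∼ a b ⟩
            toℕ a + toℕ b      ≈⟨ +-cong-∼ a∼a' b∼b' ⟩
            toℕ a' + toℕ b'    ≈⟨ addMod-∼ a' b' ⟨
            toℕ (addMod a' b') ∎
          addMod-assoc : ∀ a b c → toℕ (addMod (addMod a b) c) ∼ toℕ (addMod a (addMod b c))
          addMod-assoc a b c = begin
            toℕ (addMod (addMod a b) c)   ≈⟨ addMod-∼ (addMod a b) c ⟩
            toℕ (addMod a b) + toℕ c      ≈⟨ +-congʳ-∼ (toℕ c) (addMod-∼ a b) ⟩
            toℕ a + toℕ b + toℕ c         ≡⟨ +-assoc (toℕ a) (toℕ b) (toℕ c) ⟩
            toℕ a + (toℕ b + toℕ c)       ≈⟨ +-congˡ-∼ (toℕ a) (addMod-∼ b c) ⟨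
            toℕ a + toℕ (addMod b c)      ≈⟨ addMod-∼ a (addMod b c) ⟨
            toℕ (addMod a (addMod b c))   ∎
          addMod-comm : ∀ a b → toℕ (addMod a b) ∼ toℕ (addMod b a)
          addMod-comm a b = begin
            toℕ (addMod a b)  ≈⟨ addMod-∼ a b ⟩
            toℕ a + toℕ b     ≈⟨ +-comm-∼ (toℕ a) (toℕ b) ⟩
            toℕ b + toℕ a     ≈⟨ addMod-∼ b a ⟨
            toℕ (addMod b a)  ∎
          addMod-identityˡ : ∀ a → toℕ (addMod Fin.zero a) ∼ toℕ a
          addMod-identityˡ a = addMod-∼ Fin.zero a
          addMod-identityʳ : ∀ a → toℕ (addMod a Fin.zero) ∼ toℕ a
          addMod-identityʳ a = trans′ (addMod-∼ a Fin.zero) (≗⇒∼ λ x → cong (λ t → θ[ t ] x) (+-identityʳ (toℕ a)))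
          addMod-inverseʳ : ∀ a → toℕ (addMod a (negMod a)) ∼ 0
          addMod-inverseʳ a = trans′ (addMod-∼ a (negMod a)) (+-negMod-∼ a)
          addMod-inverseˡ : ∀ a → toℕ (addMod (negMod a) a) ∼ 0
          addMod-inverseˡ a = trans′ (addMod-comm (negMod a) a) (addMod-inverseʳ a)
          negMod-cong : ∀ {a a'} → toℕ a ∼ toℕ a' → toℕ (negMod a) ∼ toℕ (negMod a')
          negMod-cong {a} {a'} a∼a' = begin
            -a                  ≡⟨ +-identityʳ -a ⟨
            -a + 0              ≈⟨ +-congˡ-∼ -a (+-negMod-∼ a') ⟨
            -a + (toℕ a' + -a') ≡⟨ +-assoc -a (toℕ a') -a' ⟨
            -a + toℕ a' + -a'   ≈⟨ +-congʳ-∼ -a' (+-congˡ-∼ -a a∼a') ⟨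
            -a + toℕ a + -a'    ≈⟨ +-congʳ-∼ -a' (+-comm-∼ -a (toℕ a)) ⟩
            toℕ a + -a + -a'    ≈⟨ +-congʳ-∼ -a' (+-negMod-∼ a) ⟩
            -a'                 ∎
            where
            -a  = toℕ (negMod a)
            -a' = toℕ (negMod a')

theorem5p2 : (n m : ℕ) .{{_ : NonZero n}} .{{_ : NonZero m}} (R : List ℕ) →
    All (λ s → 1 ≤ s × s ≤ n / 2) R →
    (Σ ℕ λ r → r ∈ R × (1 < m × (m ∣ gcd n r × (m ^ 3) ∣ n))) →
    Σ (Fin (n / m)) λ e → Σ (Fin (n / m) → Fin (n / m)) λ inv →
    IsAbelianGroup (SameImage n m R) addMod e inv
theorem5p2 n m R _ (r , _ , _ , m∣gcd , _) = withQuotient (n / m) (trans (*-comm m (n / m)) (m/n*n≡m m∣n))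
  where
  m∣n : m ∣ n
  m∣n = ∣-trans m∣gcd (gcd[m,n]∣m n r)
  withQuotient : ∀ k → m * k ≡ n → Σ (Fin k) λ e → Σ (Fin k → Fin k) λ inv →
                 IsAbelianGroup (SameImage n m R {k}) addMod e inv
  withQuotient zero    mk≡n = ⊥-elim (≢-nonZero⁻¹ n (trans (sym mk≡n) (*-zeroʳ m)))
  withQuotient (suc k) mk≡n = Fin.zero , negMod n m R m∣n k mk≡n , isAbelianGroup n m R m∣n k mk≡n
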